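{- Let $L$ be a finite lower dismantlable lattice having $(0,1)$ as an adjunct pair. The following statements are equivalent. (a) $G_{\{0\}}(L)$ is a complete bipartite graph. (b) $L$ is an adjunct of two chains only. (c) $L$ has exactly two atoms and exactly two dual atoms. (d) There exist two minimal prime ideals $P_1,P_2$ of $L$ such that $P_1\cap P_2=\{0\}$. (e) $L$ is a $0$-distributive lattice.
   Context: Adjunct operation: for disjoint finite lattices $L_1,L_2$ and $a<b$ in $L_1$ with $b$ not covering $a$, $L_1]_a^bL_2$ is $L_1\cup L_2$ ordered by: $x\le y$ iff ($x,y\in L_1$, $x\le y$ in $L_1$) or ($x,y\in L_2$, $x\le y$ in $L_2$) or ($x\in L_1$, $y\in L_2$, $x\le a$) or ($x\in L_2$, $y\in L_1$, $b\le y$); $(a,b)$ is an adjunct pair. A finite lattice is dismantlable iff it is an adjunct of chains $C_0]_{a_1}^{b_1}C_1\cdots]_{a_n}^{b_n}C_n$; it is lower dismantlable if it is a chain or every adjunct pair in it is of the form $(0,b)$. Atoms are elements covering $0$; dual atoms are elements covered by $1$. An ideal is a nonempty down-closed subset closed under joins; a prime ideal is a proper ideal $P$ with $a\wedge b\in P\Rightarrow a\in P$ or $b\in P$; a minimal prime ideal is a prime ideal minimal under inclusion among prime ideals. $L$ is $0$-distributive if $a\wedge b=a\wedge c=0$ implies $a\wedge(b\vee c)=0$. The zero-divisor graph $G_{\{0\}}(L)$ has vertex set $\{x\in L\setminus\{0\}: x\wedge y=0\text{ for some }y\in L\setminus\{0\}\}$, distinct vertices $x,y$ adjacent iff $x\wedge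 y=0$. -}

module Defs where

open import Level using (0ℓ)
open import Data.Nat using (ℕ; suc)
open import Data.Fin using (Fin)
import Data.Fin as F
open import Data.Sum using (_⊎_; inj₁; inj₂)
open import Data.Product using (_×_; _,_; Σ; ∃; ∃-syntax)
open import Data.Bool using (Bool)
open import Data.Empty using (⊥)
open import Data.Unit using (⊤)
open import Relation.Nullary using (¬_)
open import Relation.Binary.PropositionalEquality using (_≡_; _≢_)
open import Relation.Unary using (Pred; _⊆_)
open import Function.Bundles using (_⇔_)
open import Relation.Binary.Lattice.Bundles using (BoundedLattice)

-- Adjuncts of chains, built syntactically (induction-recursion).
-- A chain is  Fin (suc k)  with its usual order (a nonempty finite chain).
-- R ] a , b [ k  is the adjunct  R ]_a^b C  where C is the chain Fin (suc k);
-- its carrier is the disjoint union  Car R ⊎ Fin (suc k).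

infixl 5 _]_,_[_

mutual
  data Rep : Set where
    chain  : ℕ → Rep
    _]_,_[_ : (R : Rep) → Car R → Car R → ℕ → Rep

  Car : Rep → Set
  Car (chain k)        = Fin (suc k)
  Car (R ] a , b [ k)  = Car R ⊎ Fin (suc k)

Le : (R : Rep) → Car R → Car R → Set
Le (chain k)       x        y        = x F.≤ y
Le (R ] a , b [ k) (inj₁ x) (inj₁ y) = Le R x y
Le (R ] a , b [ k) (inj₂ x) (inj₂ y) = x F.≤ y
Le (R ] a , b [ k) (inj₁ x) (inj₂ y) = Le R x a
Le (R ] a , b [ k) (inj₂ x) (inj₁ y) = Le R b y

Lt : (R : Rep) → Car R → Car R → Set
Lt R x y = Le R x y × x ≢ y

CoversR : (R : Rep) → Car R → Car R → Set
CoversR R a b = Lt R a b × ¬ (∃[ z ] (Lt R a z × Lt R z b))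

Valid : Rep → Set
Valid (chain k)       = ⊤
Valid (R ] a , b [ k) = Valid R × Lt R a b × ¬ CoversR R a b

AllPairsLower : Rep → Set
AllPairsLower (chain k)       = ⊤
AllPairsLower (R ] a , b [ k) = AllPairsLower R × (∀ x → Le R a x)

HasPair01 : Rep → Set
HasPair01 (chain k)       = ⊥
HasPair01 (R ] a , b [ k) = HasPair01 R ⊎ ((∀ x → Le R a x) × (∀ x → Le R x b))

IsChainRep : Rep → Set
IsChainRep (chain k)       = ⊤
IsChainRep (R ] a , b [ k) = ⊥

TwoChains : Rep → Set
TwoChains (chain k)       = ⊥
TwoChains (R ] a , b [ k) = IsChainRep R

module _ (L : BoundedLattice 0ℓ 0ℓ 0ℓ) where
  open BoundedLattice L renaming (⊤ to 𝟙; ⊥ to 𝟘)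

  record RepresentedBy (R : Rep) : Set where
    field
      to      : Car R → Carrier
      from    : Carrier → Car R
      to∘from : ∀ x → to (from x) ≈ x
      from∘to : ∀ x → from (to x) ≡ x
      mono    : ∀ x y → Le R x y → to x ≤ to y
      reflect : ∀ x y → to x ≤ to y → Le R x y

  LowerDismantlable01 : Set
  LowerDismantlable01 =
    ∃[ R ] (Valid R × RepresentedBy R × AllPairsLower R × HasPair01 R)

  AdjunctOfTwoChains : Set
  AdjunctOfTwoChains = ∃[ R ] (Valid R × RepresentedBy R × TwoChains R)

  _<_ : Carrier → Carrier → Set
  x < y = x ≤ y × ¬ (x ≈ y)

  Covers : Carrier → Carrier → Set
  Covers a b = a < b × ¬ (∃[ z ] (a < z × z < b))

  Atom : Carrier → Set
  Atom x = Covers 𝟘 x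

  DualAtom : Carrier → Set
  DualAtom x = Covers x 𝟙

  ExactlyTwo : Pred Carrier 0ℓ → Set
  ExactlyTwo P = ∃[ x ] ∃[ y ] (P x × P y × ¬ (x ≈ y) × (∀ z → P z → z ≈ x ⊎ z ≈ y))

  ZDVertex : Carrier → Set
  ZDVertex x = ¬ (x ≈ 𝟘) × ∃[ y ] (¬ (y ≈ 𝟘) × (x ∧ y) ≈ 𝟘)

  ZDAdj : Carrier → Carrier → Set
  ZDAdj x y = ¬ (x ≈ y) × (x ∧ y) ≈ 𝟘

  ZDCompleteBipartite : Set
  ZDCompleteBipartite =
    Σ (Carrier → Bool) λ side → ((∃[ x ] (ZDVertex x × side x ≡ Bool.true)) ×
               (∃[ x ] (ZDVertex x × side x ≡ Bool.false)) ×
               (∀ x y → ZDVertex x → ZDVertex y → (ZDAdj x y ⇔ (side x ≢ side y))))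

  record IsIdeal (I : Pred Carrier 0ℓ) : Set where
    field
      nonempty    : ∃[ x ] I x
      downClosed  : ∀ {x y} → I y → x ≤ y → I x
      joinClosed  : ∀ {x y} → I x → I y → I (x ∨ y)

  record IsPrimeIdeal (P : Pred Carrier 0ℓ) : Set where
    field
      isIdeal : IsIdeal P
      proper  : ∃[ x ] ¬ P x
      prime   : ∀ {x y} → P (x ∧ y) → P x ⊎ P y

  record IsMinimalPrimeIdeal (P : Pred Carrier 0ℓ) : Set₁ where
    field
      isPrime : IsPrimeIdeal P
      minimal : ∀ (Q : Pred Carrier 0ℓ) → IsPrimeIdeal Q → Q ⊆ P → P ⊆ Q

  ZeroDistributive : Set
  ZeroDistributive = ∀ a b c → (a ∧ b) ≈ 𝟘 → (a ∧ c) ≈ 𝟘 → (a ∧ (b ∨ c)) ≈ 𝟘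

-- Write L = C₀ ]_0^{b₁} C₁ ⋯ ]_0^{bₙ} Cₙ.  If n = 1, the (0,1) pair makes L two chains
-- glued at 0 and 1, with atoms c ∈ C₀ and d ∈ C₁: every element other than 0 lies above c
-- or d, and only 1 lies above both.  So {x : c ≰ x} and {x : d ≰ x} are minimal prime
-- ideals (principal, generated by the two dual atoms) meeting in 0, whence L is
-- 0-distributive, and G_{0}(L) is complete bipartite with parts ↑c∖{1} and ↑d∖{1}.
-- If n ≥ 2, L has three atoms p, q, r with q ∨ r = 1 (q the atom of a chain adjoined at
-- (0,1)), and every statement fails: the atoms form a triangle in G_{0}(L), every prime
-- ideal contains two of them, p ∧ (q ∨ r) = p ≠ 0, and an adjunct of two chains has no
-- three pairwise incomparable elements.

module Submission where

open import Defs
open import Level using (0ℓ)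
open import Data.Bool using (Bool; true; false)
open import Data.Empty using (⊥; ⊥-elim)
open import Data.Fin using (Fin; zero; suc; fromℕ; inject₁; toℕ)
import Data.Fin as F
import Data.Fin.Properties as Finₚ
import Data.Nat as ℕ
open import Data.Nat using (s≤s; z≤n)
import Data.Nat.Properties as ℕₚ
open import Data.Product using (_×_; _,_; proj₁; proj₂; ∃-syntax)
open import Data.Sum using (_⊎_; inj₁; inj₂; [_,_]; swap)
import Data.Sum as Sum
open import Data.Sum.Properties using (inj₁-injective)
open import Data.Unit using (tt)
open import Function.Base using (_∘_)
open import Function.Bundles using (_⇔_; mk⇔; Equivalence)
open import Relation.Binary.Definitions using (Decidable)
open import Relation.Binary.Lattice.Bundles using (BoundedLattice)
open import Relation.Binary.PropositionalEquality using (_≡_; _≢_; refl; cong; sym; subst)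
open import Relation.Nullary using (¬_; Dec; yes; no)
open import Relation.Nullary.Decidable using (does; map′; dec-true; dec-false)
open import Relation.Unary using (Pred; _⊆_)

both-hold⇒⇔ : ∀ {a b} {A : Set a} {B : Set b} → A → B → A ⇔ B
both-hold⇒⇔ x y = mk⇔ (λ _ → y) (λ _ → x)

both-fail⇒⇔ : ∀ {a b} {A : Set a} {B : Set b} → ¬ A → ¬ B → A ⇔ B
both-fail⇒⇔ ¬x ¬y = mk⇔ (⊥-elim ∘ ¬x) (⊥-elim ∘ ¬y)

no-three-distinct-Bools : {x y z : Bool} → x ≢ y → x ≢ z → y ≢ z → ⊥
no-three-distinct-Bools {true}  {true}          x≢y _   _   = x≢y refl
no-three-distinct-Bools {false} {false}         x≢y _   _   = x≢y refl
no-three-distinct-Bools {true}  {false} {true}  _   x≢z _   = x≢z refl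
no-three-distinct-Bools {false} {true}  {false} _   x≢z _   = x≢z refl
no-three-distinct-Bools {true}  {false} {false} _   _   y≢z = y≢z refl
no-three-distinct-Bools {false} {true}  {true}  _   _   y≢z = y≢z refl

Comparable : {A : Set} → (A → A → Set) → A → A → Set
Comparable _≤_ x y = x ≤ y ⊎ y ≤ x

-- The order of an adjunct of chains

mutual
  Le-trans : ∀ R → Valid R → ∀ {x y z} → Le R x y → Le R y z → Le R x z
  Le-trans (chain k) _ = Finₚ.≤-trans
  Le-trans (R ] a , b [ k) (v , _) {inj₁ _} {inj₁ _} {inj₁ _} = Le-trans R v
  Le-trans (R ] a , b [ k) (v , _) {inj₁ _} {inj₁ _} {inj₂ _} = Le-trans R v
  Le-trans (R ] a , b [ k) (v , a<b , _) {inj₁ _} {inj₂ _} {inj₁ _} x≤a b≤z =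
    Le-trans R v x≤a (Le-trans R v (proj₁ a<b) b≤z)
  Le-trans (R ] a , b [ k) _ {inj₁ _} {inj₂ _} {inj₂ _} x≤a _ = x≤a
  Le-trans (R ] a , b [ k) (v , _) {inj₂ _} {inj₁ _} {inj₁ _} = Le-trans R v
  Le-trans (R ] a , b [ k) (v , a<b , _) {inj₂ _} {inj₁ _} {inj₂ _} b≤y y≤a =
    ⊥-elim (Lt⇒¬Le R v a<b (Le-trans R v b≤y y≤a))
  Le-trans (R ] a , b [ k) _ {inj₂ _} {inj₂ _} {inj₁ _} _ b≤z = b≤z
  Le-trans (R ] a , b [ k) _ {inj₂ _} {inj₂ _} {inj₂ _} = Finₚ.≤-trans

  Le-antisym : ∀ R → Valid R → ∀ {x y} → Le R x y → Le R y x → x ≡ y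
  Le-antisym (chain k) _ = Finₚ.≤-antisym
  Le-antisym (R ] a , b [ k) (v , _) {inj₁ _} {inj₁ _} x≤y y≤x = cong inj₁ (Le-antisym R v x≤y y≤x)
  Le-antisym (R ] a , b [ k) _ {inj₂ _} {inj₂ _} x≤y y≤x = cong inj₂ (Finₚ.≤-antisym x≤y y≤x)
  Le-antisym (R ] a , b [ k) (v , a<b , _) {inj₁ _} {inj₂ _} x≤a b≤x =
    ⊥-elim (Lt⇒¬Le R v a<b (Le-trans R v b≤x x≤a))
  Le-antisym (R ] a , b [ k) (v , a<b , _) {inj₂ _} {inj₁ _} b≤y y≤a =
    ⊥-elim (Lt⇒¬Le R v a<b (Le-trans R v b≤y y≤a))

  Lt⇒¬Le : ∀ R → Valid R → ∀ {x y} → Lt R x y → ¬ Le R y x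
  Lt⇒¬Le R v (x≤y , x≢y) y≤x = x≢y (Le-antisym R v x≤y y≤x)

Le? : ∀ R → Decidable (Le R)
Le? (chain k) = Finₚ._≤?_
Le? (R ] a , b [ k) (inj₁ x) (inj₁ y) = Le? R x y
Le? (R ] a , b [ k) (inj₂ x) (inj₂ y) = x Finₚ.≤? y
Le? (R ] a , b [ k) (inj₁ x) (inj₂ _) = Le? R x a
Le? (R ] a , b [ k) (inj₂ _) (inj₁ y) = Le? R b y

twoChains-comparable-pair : ∀ {k₀ a b k₁} (u v w : Car (chain k₀ ] a , b [ k₁)) →
  let R = chain k₀ ] a , b [ k₁ in
  Comparable (Le R) u v ⊎ Comparable (Le R) u w ⊎ Comparable (Le R) v w
twoChains-comparable-pair (inj₁ u) (inj₁ v) _        = inj₁ (Finₚ.≤-total u v)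
twoChains-comparable-pair (inj₂ u) (inj₂ v) _        = inj₁ (Finₚ.≤-total u v)
twoChains-comparable-pair (inj₁ u) (inj₂ _) (inj₁ w) = inj₂ (inj₁ (Finₚ.≤-total u w))
twoChains-comparable-pair (inj₂ u) (inj₁ _) (inj₂ w) = inj₂ (inj₁ (Finₚ.≤-total u w))
twoChains-comparable-pair (inj₁ _) (inj₂ v) (inj₂ w) = inj₂ (inj₂ (Finₚ.≤-total v w))
twoChains-comparable-pair (inj₂ _) (inj₁ v) (inj₁ w) = inj₂ (inj₂ (Finₚ.≤-total v w))

-- Atoms of a lower adjunct of chains

IsBottom : (R : Rep) → Car R → Set
IsBottom R w = ∀ z → Le R w z

IsTop : (R : Rep) → Car R → Set
IsTop R w = ∀ z → Le R z w

IsAtom : (R : Rep) → Car R → Set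
IsAtom R u = ¬ IsBottom R u × (∀ w → Le R w u → IsBottom R w ⊎ w ≡ u)

JoinIsTop : (R : Rep) → Car R → Car R → Set
JoinIsTop R q r = ∀ w → Le R q w → Le R r w → IsTop R w

atom-covers-bottom : ∀ R → Valid R → ∀ {a u} → IsBottom R a → IsAtom R u → CoversR R a u
atom-covers-bottom R v {a} {u} a-bottom (u-not-bottom , below-u) =
  (a-bottom u , λ { refl → u-not-bottom a-bottom }) , nothing-between
  where
  nothing-between : ¬ (∃[ z ] (Lt R a z × Lt R z u))
  nothing-between (z , (a≤z , a≢z) , (z≤u , z≢u)) with below-u z z≤u
  ... | inj₁ z-bottom = a≢z (Le-antisym R v a≤z (z-bottom a))
  ... | inj₂ z≡u      = z≢u z≡u

chain-atom : ∀ {k} → IsAtom (chain (ℕ.suc k)) (suc zero)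
chain-atom {k} = (λ bottom → 1≰0 (bottom zero)) , below
  where
  1≰0 : ¬ Le (chain (ℕ.suc k)) (suc zero) zero
  1≰0 ()
  below : ∀ w → Le (chain (ℕ.suc k)) w (suc zero) → IsBottom (chain (ℕ.suc k)) w ⊎ w ≡ suc zero
  below zero          _ = inj₁ (λ _ → z≤n)
  below (suc zero)    _ = inj₂ refl
  below (suc (suc _)) (s≤s ())

module LowerAdjunction (R : Rep) (a b : Car R) (k : ℕ.ℕ) (R-valid : Valid R) (a<b : Lt R a b)
                       (¬a⋖b : ¬ CoversR R a b) (a-bottom : IsBottom R a) where

  private
    R⁺ : Rep
    R⁺ = R ] a , b [ k

  below-a-bottom : ∀ {w} → Le R w a → IsBottom R w
  below-a-bottom w≤a z = Le-trans R R-valid w≤a (a-bottom z)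

  lift-bottom : ∀ {w} → IsBottom R w → IsBottom R⁺ (inj₁ w)
  lift-bottom w-bottom (inj₁ z) = w-bottom z
  lift-bottom w-bottom (inj₂ _) = w-bottom a

  new-atom : IsAtom R⁺ (inj₂ zero)
  new-atom = (λ bottom → Lt⇒¬Le R R-valid a<b (bottom (inj₁ a))) , below
    where
    below : ∀ w → Le R⁺ w (inj₂ zero) → IsBottom R⁺ w ⊎ w ≡ inj₂ zero
    below (inj₁ _)    w≤a = inj₁ (lift-bottom (below-a-bottom w≤a))
    below (inj₂ zero) _   = inj₂ refl

  -- Only here is it used that b does not cover a: otherwise b would be an old atom
  -- lying above the new chain.
  lift-atom : ∀ {u} → IsAtom R u → IsAtom R⁺ (inj₁ u)
  lift-atom {u} (u-not-bottom , below-u) = (λ bottom → u-not-bottom (bottom ∘ inj₁)) , below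
    where
    below : ∀ w → Le R⁺ w (inj₁ u) → IsBottom R⁺ w ⊎ w ≡ inj₁ u
    below (inj₁ w) w≤u with below-u w w≤u
    ... | inj₁ w-bottom = inj₁ (lift-bottom w-bottom)
    ... | inj₂ refl     = inj₂ refl
    below (inj₂ _) b≤u with below-u b b≤u
    ... | inj₁ b-bottom = ⊥-elim (Lt⇒¬Le R R-valid a<b (b-bottom a))
    ... | inj₂ refl     = ⊥-elim (¬a⋖b (atom-covers-bottom R R-valid a-bottom (u-not-bottom , below-u)))

  new-atom-joinIsTop : IsTop R b → ∀ {s} → IsAtom R s → JoinIsTop R⁺ (inj₂ zero) (inj₁ s)
  new-atom-joinIsTop b-top _ (inj₁ w) b≤w _ (inj₁ z) = Le-trans R R-valid (b-top z) b≤w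
  new-atom-joinIsTop b-top _ (inj₁ w) b≤w _ (inj₂ _) = b≤w
  new-atom-joinIsTop b-top (s-not-bottom , _) (inj₂ _) _ s≤a = ⊥-elim (s-not-bottom (below-a-bottom s≤a))

  lift-joinIsTop : ∀ {q r} → IsAtom R q → JoinIsTop R q r → JoinIsTop R⁺ (inj₁ q) (inj₁ r)
  lift-joinIsTop _ q∨r-top (inj₁ w) q≤w r≤w (inj₁ z) = q∨r-top w q≤w r≤w z
  lift-joinIsTop _ q∨r-top (inj₁ w) q≤w r≤w (inj₂ _) = q∨r-top w q≤w r≤w b
  lift-joinIsTop (q-not-bottom , _) _ (inj₂ _) q≤a _ = ⊥-elim (q-not-bottom (below-a-bottom q≤a))

atom-exists : ∀ R → Valid R → AllPairsLower R → ∀ {x y} → Lt R x y → ∃[ u ] IsAtom R u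
atom-exists (chain ℕ.zero) _ _ {zero} {zero} (_ , x≢y) = ⊥-elim (x≢y refl)
atom-exists (chain (ℕ.suc k)) _ _ _ = suc zero , chain-atom
atom-exists (R ] a , b [ k) (v , a<b , ¬a⋖b) (_ , a-bottom) _ =
  inj₂ zero , LowerAdjunction.new-atom R a b k v a<b ¬a⋖b a-bottom

record TopJoiningAtoms (R : Rep) : Set where
  field
    q r      : Car R
    q-atom   : IsAtom R q
    r-atom   : IsAtom R r
    q≢r      : q ≢ r
    join-top : JoinIsTop R q r

topJoiningAtoms : ∀ R → Valid R → AllPairsLower R → HasPair01 R → TopJoiningAtoms R
topJoiningAtoms (chain _) _ _ ()
topJoiningAtoms (R ] a , b [ k) (v , a<b , ¬a⋖b) (lower , a-bottom) (inj₁ pair01) = record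
  { q = inj₁ q ; r = inj₁ r ; q-atom = lift-atom q-atom ; r-atom = lift-atom r-atom
  ; q≢r = q≢r ∘ inj₁-injective ; join-top = lift-joinIsTop q-atom join-top }
  where
  open TopJoiningAtoms (topJoiningAtoms R v lower pair01)
  open LowerAdjunction R a b k v a<b ¬a⋖b a-bottom
topJoiningAtoms (R ] a , b [ k) (v , a<b , ¬a⋖b) (lower , a-bottom) (inj₂ (_ , b-top)) = record
  { q = inj₂ zero ; r = inj₁ (proj₁ s) ; q-atom = new-atom ; r-atom = lift-atom (proj₂ s)
  ; q≢r = λ () ; join-top = new-atom-joinIsTop b-top (proj₂ s) }
  where
  open LowerAdjunction R a b k v a<b ¬a⋖b a-bottom
  s : ∃[ u ] IsAtom R u
  s = atom-exists R v lower a<b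

record ThreeRepAtoms (R : Rep) : Set where
  field
    p q r    : Car R
    p-atom   : IsAtom R p
    q-atom   : IsAtom R q
    r-atom   : IsAtom R r
    p≢q      : p ≢ q
    p≢r      : p ≢ r
    q≢r      : q ≢ r
    join-top : JoinIsTop R q r

threeRepAtoms : ∀ R₂ a₂ b₂ k₂ a b k → let R = (R₂ ] a₂ , b₂ [ k₂) ] a , b [ k in
  Valid R → AllPairsLower R → HasPair01 R → ThreeRepAtoms R
threeRepAtoms R₂ a₂ b₂ k₂ a b k (v₁ , a<b , ¬a⋖b) (lower₁ , a-bottom) (inj₁ pair01) = record
  { p = inj₂ zero ; q = inj₁ q ; r = inj₁ r
  ; p-atom = new-atom ; q-atom = lift-atom q-atom ; r-atom = lift-atom r-atom
  ; p≢q = λ () ; p≢r = λ () ; q≢r = q≢r ∘ inj₁-injective ; join-top = lift-joinIsTop q-atom join-top }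
  where
  open TopJoiningAtoms (topJoiningAtoms (R₂ ] a₂ , b₂ [ k₂) v₁ lower₁ pair01)
  open LowerAdjunction (R₂ ] a₂ , b₂ [ k₂) a b k v₁ a<b ¬a⋖b a-bottom
threeRepAtoms R₂ a₂ b₂ k₂ a b k (v₁@(v₂ , a₂<b₂ , ¬a₂⋖b₂) , a<b , ¬a⋖b) ((lower₂ , a₂-bottom) , a-bottom)
              (inj₂ (_ , b-top)) = record
  { p = inj₁ (inj₁ (proj₁ s)) ; q = inj₂ zero ; r = inj₁ (inj₂ zero)
  ; p-atom = lift-atom (Inner.lift-atom (proj₂ s)) ; q-atom = new-atom ; r-atom = lift-atom Inner.new-atom
  ; p≢q = λ () ; p≢r = λ () ; q≢r = λ () ; join-top = new-atom-joinIsTop b-top Inner.new-atom }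
  where
  module Inner = LowerAdjunction R₂ a₂ b₂ k₂ v₂ a₂<b₂ ¬a₂⋖b₂ a₂-bottom
  open LowerAdjunction (R₂ ] a₂ , b₂ [ k₂) a b k v₁ a<b ¬a⋖b a-bottom
  s : ∃[ u ] IsAtom R₂ u
  s = atom-exists R₂ v₂ lower₂ a₂<b₂

-- Lattice-theoretic consequences

module LatticeFacts (L : BoundedLattice 0ℓ 0ℓ 0ℓ) where
  open BoundedLattice L renaming (⊤ to 𝟙; ⊥ to 𝟘; refl to ≤-refl; trans to ≤-trans)

  HasDisjointMinimalPrimes : Set₁
  HasDisjointMinimalPrimes =
    ∃[ P₁ ] ∃[ P₂ ] (IsMinimalPrimeIdeal L P₁ × IsMinimalPrimeIdeal L P₂ × (∀ x → P₁ x → P₂ x → x ≈ 𝟘))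

  ≤𝟘⇒≈𝟘 : ∀ {x} → x ≤ 𝟘 → x ≈ 𝟘
  ≤𝟘⇒≈𝟘 x≤𝟘 = antisym x≤𝟘 (minimum _)

  below-disjoint⇒≈𝟘 : ∀ {w x y} → w ≤ x → w ≤ y → x ∧ y ≈ 𝟘 → w ≈ 𝟘
  below-disjoint⇒≈𝟘 w≤x w≤y x∧y≈𝟘 = ≤𝟘⇒≈𝟘 (≤-trans (∧-greatest w≤x w≤y) (reflexive x∧y≈𝟘))

  ≰-∧ : ∀ {w x y} → ¬ w ≤ x ⊎ ¬ w ≤ y → ¬ w ≤ x ∧ y
  ≰-∧ (inj₁ w≰x) w≤x∧y = w≰x (≤-trans w≤x∧y (x∧y≤x _ _))
  ≰-∧ (inj₂ w≰y) w≤x∧y = w≰y (≤-trans w≤x∧y (x∧y≤y _ _))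

  atom⇒≉𝟘 : ∀ {x} → Atom L x → ¬ x ≈ 𝟘
  atom⇒≉𝟘 ((_ , 𝟘≉x) , _) x≈𝟘 = 𝟘≉x (Eq.sym x≈𝟘)

  atoms-incomparable : ∀ {x y} → Atom L x → Atom L y → ¬ x ≈ y → ¬ Comparable _≤_ x y
  atoms-incomparable x-atom (_ , nothing-below-y) x≉y (inj₁ x≤y) =
    nothing-below-y (_ , proj₁ x-atom , x≤y , x≉y)
  atoms-incomparable (_ , nothing-below-x) y-atom x≉y (inj₂ y≤x) =
    nothing-below-x (_ , proj₁ y-atom , y≤x , x≉y ∘ Eq.sym)

  primeIdeal-∋-meet≈𝟘 : ∀ {P} → IsPrimeIdeal L P → ∀ {x y} → x ∧ y ≈ 𝟘 → P x ⊎ P y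
  primeIdeal-∋-meet≈𝟘 P-prime x∧y≈𝟘 =
    prime (downClosed (proj₂ nonempty) (≤-trans (reflexive x∧y≈𝟘) (minimum _)))
    where
    open IsPrimeIdeal P-prime
    open IsIdeal isIdeal

  record ThreeAtoms : Set where
    field
      p q r  : Carrier
      p-atom : Atom L p
      q-atom : Atom L q
      r-atom : Atom L r
      p≉q    : ¬ p ≈ q
      p≉r    : ¬ p ≈ r
      q≉r    : ¬ q ≈ r
      𝟙≤q∨r  : 𝟙 ≤ q ∨ r

  ¬exactlyTwoAtoms : ThreeAtoms → ¬ ExactlyTwo L (Atom L)
  ¬exactlyTwoAtoms T (_ , _ , _ , _ , _ , x-or-y) =
    [ (λ p≈x → pigeonhole p≈x (x-or-y q q-atom) (x-or-y r r-atom))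
    , (λ p≈y → pigeonhole p≈y (swap (x-or-y q q-atom)) (swap (x-or-y r r-atom))) ] (x-or-y p p-atom)
    where
    open ThreeAtoms T
    pigeonhole : ∀ {x y} → p ≈ x → q ≈ x ⊎ q ≈ y → r ≈ x ⊎ r ≈ y → ⊥
    pigeonhole p≈x (inj₁ q≈x) _          = p≉q (Eq.trans p≈x (Eq.sym q≈x))
    pigeonhole p≈x (inj₂ _)   (inj₁ r≈x) = p≉r (Eq.trans p≈x (Eq.sym r≈x))
    pigeonhole _   (inj₂ q≈y) (inj₂ r≈y) = q≉r (Eq.trans q≈y (Eq.sym r≈y))

  record GreatestNotAbove (c t : Carrier) : Set where
    field
      c≰t : ¬ c ≤ t
      ≤t  : ∀ {x} → ¬ c ≤ x → x ≤ t

  -- c and d are the atoms of two chains glued at 𝟘 and 𝟙; t₁ and t₂ are the dual atoms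
  -- of the chains through d and through c respectively.
  record TwoBranches : Set where
    field
      c d t₁ t₂   : Carrier
      c≰d         : ¬ c ≤ d
      d≰c         : ¬ d ≤ c
      neither⇒≈𝟘  : ∀ {x} → ¬ c ≤ x → ¬ d ≤ x → x ≈ 𝟘
      both⇒𝟙≤     : ∀ {x} → c ≤ x → d ≤ x → 𝟙 ≤ x
      t₁-greatest : GreatestNotAbove c t₁
      t₂-greatest : GreatestNotAbove d t₂

  module _ (_≤?_ : Decidable _≤_) where

    distinct-atoms-meet : ∀ {x y} → Atom L x → Atom L y → ¬ x ≈ y → x ∧ y ≈ 𝟘
    distinct-atoms-meet {x} {y} x-atom y-atom x≉y with (x ∧ y) ≤? 𝟘
    ... | yes x∧y≤𝟘 = ≤𝟘⇒≈𝟘 x∧y≤𝟘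
    ... | no  x∧y≰𝟘 = ⊥-elim (proj₂ x-atom (x ∧ y , 𝟘<x∧y , x∧y≤x x y , x∧y≉x))
      where
      𝟘<x∧y : 𝟘 ≤ x ∧ y × ¬ 𝟘 ≈ x ∧ y
      𝟘<x∧y = minimum _ , λ 𝟘≈x∧y → x∧y≰𝟘 (reflexive (Eq.sym 𝟘≈x∧y))
      x∧y≉x : ¬ x ∧ y ≈ x
      x∧y≉x x∧y≈x = atoms-incomparable x-atom y-atom x≉y
                      (inj₁ (≤-trans (reflexive (Eq.sym x∧y≈x)) (x∧y≤y x y)))

    atom-vertex : ∀ {x y} → Atom L x → Atom L y → ¬ x ≈ y → ZDVertex L x
    atom-vertex x-atom y-atom x≉y =
      atom⇒≉𝟘 x-atom , _ , atom⇒≉𝟘 y-atom , distinct-atoms-meet x-atom y-atom x≉y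

    module _ (T : ThreeAtoms) where
      open ThreeAtoms T

      ¬completeBipartite : ¬ ZDCompleteBipartite L
      ¬completeBipartite (side , _ , _ , adjacent⇔) =
        no-three-distinct-Bools (sides-differ p-atom q-atom p≉q) (sides-differ p-atom r-atom p≉r)
                                (sides-differ q-atom r-atom q≉r)
        where
        sides-differ : ∀ {x y} → Atom L x → Atom L y → ¬ x ≈ y → side x ≢ side y
        sides-differ x-atom y-atom x≉y =
          Equivalence.to (adjacent⇔ _ _ (atom-vertex x-atom y-atom x≉y) (atom-vertex y-atom x-atom (x≉y ∘ Eq.sym)))
                         (x≉y , distinct-atoms-meet x-atom y-atom x≉y)

      ¬disjointMinimalPrimes : ¬ HasDisjointMinimalPrimes
      ¬disjointMinimalPrimes (P₁ , P₂ , P₁-minimal , P₂-minimal , disjoint) =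
        [ not-in-P₁ p-atom q-atom r-atom p≉q p≉r q≉r
        , not-in-P₁ q-atom p-atom r-atom (p≉q ∘ Eq.sym) q≉r p≉r ]
          (primeIdeal-∋-meet≈𝟘 P₁-prime (distinct-atoms-meet p-atom q-atom p≉q))
        where
        P₁-prime : IsPrimeIdeal L P₁
        P₁-prime = IsMinimalPrimeIdeal.isPrime P₁-minimal
        P₂-prime : IsPrimeIdeal L P₂
        P₂-prime = IsMinimalPrimeIdeal.isPrime P₂-minimal
        not-in-both : ∀ {x} → Atom L x → P₁ x → ¬ P₂ x
        not-in-both x-atom x∈P₁ x∈P₂ = atom⇒≉𝟘 x-atom (disjoint _ x∈P₁ x∈P₂)
        -- P₂ must then contain y and z, and P₁ one of them.
        not-in-P₁ : ∀ {x y z} → Atom L x → Atom L y → Atom L z →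
                    ¬ x ≈ y → ¬ x ≈ z → ¬ y ≈ z → ¬ P₁ x
        not-in-P₁ x-atom y-atom z-atom x≉y x≉z y≉z x∈P₁
          with primeIdeal-∋-meet≈𝟘 P₂-prime (distinct-atoms-meet x-atom y-atom x≉y)
             | primeIdeal-∋-meet≈𝟘 P₂-prime (distinct-atoms-meet x-atom z-atom x≉z)
             | primeIdeal-∋-meet≈𝟘 P₁-prime (distinct-atoms-meet y-atom z-atom y≉z)
        ... | inj₁ x∈P₂ | _         | _         = not-in-both x-atom x∈P₁ x∈P₂
        ... | inj₂ _    | inj₁ x∈P₂ | _         = not-in-both x-atom x∈P₁ x∈P₂
        ... | inj₂ y∈P₂ | inj₂ _    | inj₁ y∈P₁ = not-in-both y-atom y∈P₁ y∈P₂
        ... | inj₂ _    | inj₂ z∈P₂ | inj₂ z∈P₁ = not-in-both z-atom z∈P₁ z∈P₂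

      ¬zeroDistributive : ¬ ZeroDistributive L
      ¬zeroDistributive zero-distributive =
        atom⇒≉𝟘 p-atom (≤𝟘⇒≈𝟘 (≤-trans p≤p∧[q∨r] (reflexive p∧[q∨r]≈𝟘)))
        where
        p≤p∧[q∨r] : p ≤ p ∧ (q ∨ r)
        p≤p∧[q∨r] = ∧-greatest ≤-refl (≤-trans (maximum p) 𝟙≤q∨r)
        p∧[q∨r]≈𝟘 : p ∧ (q ∨ r) ≈ 𝟘
        p∧[q∨r]≈𝟘 = zero-distributive p q r (distinct-atoms-meet p-atom q-atom p≉q)
                                              (distinct-atoms-meet p-atom r-atom p≉r)

    module Branch {c d t : Carrier} (c≰d : ¬ c ≤ d) (d≰c : ¬ d ≤ c)
                  (neither⇒≈𝟘 : ∀ {x} → ¬ c ≤ x → ¬ d ≤ x → x ≈ 𝟘)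
                  (both⇒𝟙≤ : ∀ {x} → c ≤ x → d ≤ x → 𝟙 ≤ x)
                  (t-greatest : GreatestNotAbove c t) where
      open GreatestNotAbove t-greatest

      NotAbove : Pred Carrier 0ℓ
      NotAbove x = ¬ c ≤ x

      c≉𝟘 : ¬ c ≈ 𝟘
      c≉𝟘 c≈𝟘 = c≰t (≤-trans (reflexive c≈𝟘) (minimum t))

      notAbove-isPrimeIdeal : IsPrimeIdeal L NotAbove
      notAbove-isPrimeIdeal = record
        { isIdeal = record
          { nonempty   = 𝟘 , c≉𝟘 ∘ ≤𝟘⇒≈𝟘
          ; downClosed = λ c≰y x≤y c≤x → c≰y (≤-trans c≤x x≤y)
          ; joinClosed = λ c≰x c≰y c≤x∨y → c≰t (≤-trans c≤x∨y (∨-least (≤t c≰x) (≤t c≰y)))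
          }
        ; proper  = c , λ c≰c → c≰c ≤-refl
        ; prime   = prime
        }
        where
        prime : ∀ {x y} → NotAbove (x ∧ y) → NotAbove x ⊎ NotAbove y
        prime {x} {y} c≰x∧y with c ≤? x | c ≤? y
        ... | no  c≰x | _       = inj₁ c≰x
        ... | yes _   | no  c≰y = inj₂ c≰y
        ... | yes c≤x | yes c≤y = ⊥-elim (c≰x∧y (∧-greatest c≤x c≤y))

      notAbove-isMinimalPrimeIdeal : IsMinimalPrimeIdeal L NotAbove
      notAbove-isMinimalPrimeIdeal = record { isPrime = notAbove-isPrimeIdeal ; minimal = minimal }
        where
        -- x ∧ c is above neither c nor d, so it is 𝟘 ∈ Q; as c ∉ Q, primality puts x in Q.
        minimal : ∀ Q → IsPrimeIdeal L Q → Q ⊆ NotAbove → NotAbove ⊆ Q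
        minimal Q Q-prime Q⊆NotAbove {x} c≰x
          with primeIdeal-∋-meet≈𝟘 Q-prime (neither⇒≈𝟘 (≰-∧ (inj₁ c≰x)) (≰-∧ (inj₂ d≰c)))
        ... | inj₁ x∈Q = x∈Q
        ... | inj₂ c∈Q = ⊥-elim (Q⊆NotAbove c∈Q ≤-refl)

      c-atom : Atom L c
      c-atom = (minimum c , c≉𝟘 ∘ Eq.sym) , λ (z , (_ , 𝟘≉z) , z≤c , z≉c) →
        𝟘≉z (Eq.sym (neither⇒≈𝟘 (λ c≤z → z≉c (antisym z≤c c≤z)) (λ d≤z → d≰c (≤-trans d≤z z≤c))))

      atom-above-c : ∀ {z} → Atom L z → c ≤ z → z ≈ c
      atom-above-c {z} (_ , nothing-below-z) c≤z with z ≤? c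
      ... | yes z≤c = antisym z≤c c≤z
      ... | no  z≰c = ⊥-elim (nothing-below-z (c , proj₁ c-atom , c≤z , λ c≈z → z≰c (reflexive (Eq.sym c≈z))))

      t≉𝟙 : ¬ t ≈ 𝟙
      t≉𝟙 t≈𝟙 = c≰t (≤-trans (maximum c) (reflexive (Eq.sym t≈𝟙)))

      t-dualAtom : DualAtom L t
      t-dualAtom = (maximum t , t≉𝟙) , λ (m , (t≤m , t≉m) , _ , m≉𝟙) → nothing-between t≤m t≉m m≉𝟙
        where
        nothing-between : ∀ {m} → t ≤ m → ¬ t ≈ m → ¬ m ≈ 𝟙 → ⊥
        nothing-between {m} t≤m t≉m m≉𝟙 with c ≤? m
        ... | no  c≰m = t≉m (antisym t≤m (≤t c≰m))
        ... | yes c≤m = m≉𝟙 (antisym (maximum m) (both⇒𝟙≤ c≤m (≤-trans (≤t c≰d) t≤m)))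

      dualAtom-not-above-c : ∀ {z} → DualAtom L z → ¬ c ≤ z → z ≈ t
      dualAtom-not-above-c {z} (_ , nothing-above-z) c≰z with t ≤? z
      ... | yes t≤z = antisym (≤t c≰z) t≤z
      ... | no  t≰z =
        ⊥-elim (nothing-above-z (t , (≤t c≰z , λ z≈t → t≰z (reflexive (Eq.sym z≈t))) , proj₁ t-dualAtom))

      notAbove-meet-join : ∀ {a x y} → a ∧ x ≈ 𝟘 → a ∧ y ≈ 𝟘 → NotAbove (a ∧ (x ∨ y))
      notAbove-meet-join {a} {x} {y} a∧x≈𝟘 a∧y≈𝟘 c≤a∧[x∨y] =
        c≰t (≤-trans (≤-trans c≤a∧[x∨y] (x∧y≤y a (x ∨ y))) (∨-least (≤t (c≰ a∧x≈𝟘)) (≤t (c≰ a∧y≈𝟘))))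
        where
        c≰ : ∀ {w} → a ∧ w ≈ 𝟘 → ¬ c ≤ w
        c≰ a∧w≈𝟘 c≤w = c≉𝟘 (below-disjoint⇒≈𝟘 (≤-trans c≤a∧[x∨y] (x∧y≤x a (x ∨ y))) c≤w a∧w≈𝟘)

      vertex-above-c⇒not-above-d : ∀ {x} → ZDVertex L x → c ≤ x → ¬ d ≤ x
      vertex-above-c⇒not-above-d {x} (_ , y , y≉𝟘 , x∧y≈𝟘) c≤x d≤x =
        y≉𝟘 (below-disjoint⇒≈𝟘 (≤-trans (maximum y) (both⇒𝟙≤ c≤x d≤x)) ≤-refl x∧y≈𝟘)

      vertex-not-above-c⇒above-d : ∀ {x} → ZDVertex L x → ¬ c ≤ x → d ≤ x
      vertex-not-above-c⇒above-d {x} (x≉𝟘 , _) c≰x with d ≤? x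
      ... | yes d≤x = d≤x
      ... | no  d≰x = ⊥-elim (x≉𝟘 (neither⇒≈𝟘 c≰x d≰x))

    module _ (B : TwoBranches) where
      open TwoBranches B
      module C = Branch c≰d d≰c neither⇒≈𝟘 both⇒𝟙≤ t₁-greatest
      module D = Branch d≰c c≰d (λ d≰x c≰x → neither⇒≈𝟘 c≰x d≰x) (λ d≤x c≤x → both⇒𝟙≤ c≤x d≤x) t₂-greatest

      twoBranches-exactlyTwoAtoms : ExactlyTwo L (Atom L)
      twoBranches-exactlyTwoAtoms = c , d , C.c-atom , D.c-atom , c≰d ∘ reflexive , classify
        where
        classify : ∀ z → Atom L z → z ≈ c ⊎ z ≈ d
        classify z z-atom with c ≤? z | d ≤? z
        ... | yes c≤z | _       = inj₁ (C.atom-above-c z-atom c≤z)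
        ... | no  _   | yes d≤z = inj₂ (D.atom-above-c z-atom d≤z)
        ... | no  c≰z | no  d≰z = ⊥-elim (atom⇒≉𝟘 z-atom (neither⇒≈𝟘 c≰z d≰z))

      twoBranches-exactlyTwoDualAtoms : ExactlyTwo L (DualAtom L)
      twoBranches-exactlyTwoDualAtoms = t₁ , t₂ , C.t-dualAtom , D.t-dualAtom , t₁≉t₂ , classify
        where
        t₁≉t₂ : ¬ t₁ ≈ t₂
        t₁≉t₂ t₁≈t₂ = GreatestNotAbove.c≰t t₂-greatest
                        (≤-trans (GreatestNotAbove.≤t t₁-greatest c≰d) (reflexive t₁≈t₂))
        classify : ∀ z → DualAtom L z → z ≈ t₁ ⊎ z ≈ t₂
        classify z z-dualAtom@((_ , z≉𝟙) , _) with c ≤? z | d ≤? z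
        ... | no  c≰z | _       = inj₁ (C.dualAtom-not-above-c z-dualAtom c≰z)
        ... | yes _   | no  d≰z = inj₂ (D.dualAtom-not-above-c z-dualAtom d≰z)
        ... | yes c≤z | yes d≤z = ⊥-elim (z≉𝟙 (antisym (maximum z) (both⇒𝟙≤ c≤z d≤z)))

      twoBranches-disjointMinimalPrimes : HasDisjointMinimalPrimes
      twoBranches-disjointMinimalPrimes =
        C.NotAbove , D.NotAbove , C.notAbove-isMinimalPrimeIdeal , D.notAbove-isMinimalPrimeIdeal ,
        λ _ → neither⇒≈𝟘

      twoBranches-zeroDistributive : ZeroDistributive L
      twoBranches-zeroDistributive _ _ _ a∧x≈𝟘 a∧y≈𝟘 =
        neither⇒≈𝟘 (C.notAbove-meet-join a∧x≈𝟘 a∧y≈𝟘) (D.notAbove-meet-join a∧x≈𝟘 a∧y≈𝟘)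

      twoBranches-completeBipartite : ZDCompleteBipartite L
      twoBranches-completeBipartite =
        (λ x → does (c ≤? x)) ,
        (c , atom-vertex C.c-atom D.c-atom c≉d , dec-true (c ≤? c) ≤-refl) ,
        (d , atom-vertex D.c-atom C.c-atom (c≉d ∘ Eq.sym) , dec-false (c ≤? d) c≰d) ,
        λ x y x-vertex y-vertex → adjacent⇔ x-vertex y-vertex (c ≤? x) (c ≤? y)
        where
        c≉d : ¬ c ≈ d
        c≉d = c≰d ∘ reflexive
        adjacent⇔ : ∀ {x y} → ZDVertex L x → ZDVertex L y → (c?x : Dec (c ≤ x)) (c?y : Dec (c ≤ y)) →
                    ZDAdj L x y ⇔ (does c?x ≢ does c?y)
        adjacent⇔ _ _ (yes c≤x) (yes c≤y) =
          both-fail⇒⇔ (λ (_ , x∧y≈𝟘) → C.c≉𝟘 (below-disjoint⇒≈𝟘 c≤x c≤y x∧y≈𝟘)) (λ ne → ne refl)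
        adjacent⇔ x-vertex y-vertex (no c≰x) (no c≰y) =
          both-fail⇒⇔ (λ (_ , x∧y≈𝟘) → D.c≉𝟘 (below-disjoint⇒≈𝟘 (C.vertex-not-above-c⇒above-d x-vertex c≰x)
                                                                (C.vertex-not-above-c⇒above-d y-vertex c≰y) x∧y≈𝟘))
                      (λ ne → ne refl)
        adjacent⇔ x-vertex _ (yes c≤x) (no c≰y) = both-hold⇒⇔
          ((λ x≈y → c≰y (≤-trans c≤x (reflexive x≈y))) ,
           neither⇒≈𝟘 (≰-∧ (inj₂ c≰y)) (≰-∧ (inj₁ (C.vertex-above-c⇒not-above-d x-vertex c≤x))))
          (λ ())
        adjacent⇔ _ y-vertex (no c≰x) (yes c≤y) = both-hold⇒⇔
          ((λ x≈y → c≰x (≤-trans c≤y (reflexive (Eq.sym x≈y)))) ,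
           neither⇒≈𝟘 (≰-∧ (inj₁ c≰x)) (≰-∧ (inj₂ (C.vertex-above-c⇒not-above-d y-vertex c≤y))))
          (λ ())

-- Adjuncts of two chains with (0,1) as adjunct pair

record RepTwoBranches (R : Rep) : Set where
  field
    c d t₁ t₂       : Car R
    c≰d             : ¬ Le R c d
    d≰c             : ¬ Le R d c
    neither⇒bottom  : ∀ v → ¬ Le R c v → ¬ Le R d v → IsBottom R v
    both⇒top        : ∀ v → Le R c v → Le R d v → IsTop R v
    c≰t₁            : ¬ Le R c t₁
    ≤t₁             : ∀ v → ¬ Le R c v → Le R v t₁
    d≰t₂            : ¬ Le R d t₂
    ≤t₂             : ∀ v → ¬ Le R d v → Le R v t₂

gluedChains-twoBranches : ∀ {m} (b′ : Fin m) k → (∀ x → x F.≤ suc (suc b′)) →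
  RepTwoBranches (chain (ℕ.suc m) ] zero , suc (suc b′) [ k)
gluedChains-twoBranches {m} b′ k b-top = record
  { c = inj₁ (suc zero) ; d = inj₂ zero ; t₁ = inj₂ (fromℕ k) ; t₂ = inj₁ (inject₁ (suc b′))
  ; c≰d = λ () ; d≰c = λ { (s≤s ()) }
  ; neither⇒bottom = neither⇒bottom ; both⇒top = both⇒top
  ; c≰t₁ = λ () ; ≤t₁ = ≤t₁
  ; d≰t₂ = ℕₚ.<⇒≱ (Finₚ.≤̄⇒inject₁< Finₚ.≤-refl) ; ≤t₂ = ≤t₂
  }
  where
  R : Rep
  R = chain (ℕ.suc m) ] zero , suc (suc b′) [ k
  neither⇒bottom : ∀ v → ¬ Le R (inj₁ (suc zero)) v → ¬ Le R (inj₂ zero) v → IsBottom R v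
  neither⇒bottom (inj₁ zero)    _   _   (inj₁ _) = z≤n
  neither⇒bottom (inj₁ zero)    _   _   (inj₂ _) = z≤n
  neither⇒bottom (inj₁ (suc _)) c≰v _   = ⊥-elim (c≰v (s≤s z≤n))
  neither⇒bottom (inj₂ _)       _   d≰v = ⊥-elim (d≰v z≤n)
  both⇒top : ∀ v → Le R (inj₁ (suc zero)) v → Le R (inj₂ zero) v → IsTop R v
  both⇒top (inj₁ _) _ b≤v (inj₁ z) = Finₚ.≤-trans (b-top z) b≤v
  both⇒top (inj₁ _) _ b≤v (inj₂ _) = b≤v
  both⇒top (inj₂ _) () _
  ≤t₁ : ∀ v → ¬ Le R (inj₁ (suc zero)) v → Le R v (inj₂ (fromℕ k))
  ≤t₁ (inj₁ zero)    _   = z≤n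
  ≤t₁ (inj₁ (suc _)) c≰v = ⊥-elim (c≰v (s≤s z≤n))
  ≤t₁ (inj₂ j)       _   = Finₚ.≤fromℕ j
  ≤t₂ : ∀ v → ¬ Le R (inj₂ zero) v → Le R v (inj₁ (inject₁ (suc b′)))
  ≤t₂ (inj₁ i) b≰i = subst (toℕ i ℕ.≤_) (sym (Finₚ.toℕ-inject₁ (suc b′))) (ℕ.s≤s⁻¹ (ℕₚ.≰⇒> b≰i))
  ≤t₂ (inj₂ _) d≰v = ⊥-elim (d≰v z≤n)

-- Lowerness forces a = 0, the (0,1) pair forces b to be the top, and b, not covering 0, is not 1.
pair01-twoBranches : ∀ k₀ a b k₁ → let R = chain k₀ ] a , b [ k₁ in
  Valid R → AllPairsLower R → HasPair01 R → RepTwoBranches R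
pair01-twoBranches _ _ _ _ _ _ (inj₁ ())
pair01-twoBranches _ (suc _) _ _ _ (_ , a-bottom) _ with a-bottom zero
... | ()
pair01-twoBranches _ zero zero _ (_ , (_ , 0≢0) , _) _ _ = ⊥-elim (0≢0 refl)
pair01-twoBranches k₀ zero (suc zero) _ (_ , 0<1 , ¬0⋖1) _ _ = ⊥-elim (¬0⋖1 (0<1 , nothing-between))
  where
  nothing-between : ¬ (∃[ z ] (Lt (chain k₀) zero z × Lt (chain k₀) z (suc zero)))
  nothing-between (zero          , (_ , 0≢0) , _)        = 0≢0 refl
  nothing-between (suc zero      , _         , (_ , 1≢1)) = 1≢1 refl
  nothing-between (suc (suc _)   , _         , (s≤s () , _))
pair01-twoBranches _ zero (suc (suc b′)) k₁ _ _ (inj₂ (_ , b-top)) = gluedChains-twoBranches b′ k₁ b-top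

-- Transport along a representation

module Transfer {L : BoundedLattice 0ℓ 0ℓ 0ℓ} {R : Rep} (ρ : RepresentedBy L R) where
  open BoundedLattice L renaming (⊤ to 𝟙; ⊥ to 𝟘; refl to ≤-refl; trans to ≤-trans)
  open RepresentedBy ρ
  open LatticeFacts L using (≤𝟘⇒≈𝟘; ThreeAtoms; TwoBranches)

  to≤⇒Le : ∀ {u x} → to u ≤ x → Le R u (from x)
  to≤⇒Le {u} {x} u≤x = reflect u (from x) (≤-trans u≤x (reflexive (Eq.sym (to∘from x))))

  Le⇒to≤ : ∀ {u x} → Le R u (from x) → to u ≤ x
  Le⇒to≤ {u} {x} u≤x = ≤-trans (mono u (from x) u≤x) (reflexive (to∘from x))

  ≤to⇒Le : ∀ {x u} → x ≤ to u → Le R (from x) u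
  ≤to⇒Le {x} {u} x≤u = reflect (from x) u (≤-trans (reflexive (to∘from x)) x≤u)

  Le⇒≤to : ∀ {x u} → Le R (from x) u → x ≤ to u
  Le⇒≤to {x} {u} x≤u = ≤-trans (reflexive (Eq.sym (to∘from x))) (mono (from x) u x≤u)

  Le⇒≤ : ∀ {x y} → Le R (from x) (from y) → x ≤ y
  Le⇒≤ {y = y} x≤y = ≤-trans (Le⇒≤to x≤y) (reflexive (to∘from y))

  ≤⇒Le : ∀ {x y} → x ≤ y → Le R (from x) (from y)
  ≤⇒Le {y = y} x≤y = ≤to⇒Le (≤-trans x≤y (reflexive (Eq.sym (to∘from y))))

  ≤-dec : Decidable _≤_
  ≤-dec x y = map′ Le⇒≤ ≤⇒Le (Le? R (from x) (from y))

  to-injective : Valid R → ∀ {u v} → to u ≈ to v → u ≡ v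
  to-injective valid u≈v =
    Le-antisym R valid (reflect _ _ (reflexive u≈v)) (reflect _ _ (reflexive (Eq.sym u≈v)))

  from-bottom⇒≈𝟘 : ∀ {x} → IsBottom R (from x) → x ≈ 𝟘
  from-bottom⇒≈𝟘 x-bottom = ≤𝟘⇒≈𝟘 (Le⇒≤ (x-bottom (from 𝟘)))

  from-top⇒𝟙≤ : ∀ {x} → IsTop R (from x) → 𝟙 ≤ x
  from-top⇒𝟙≤ x-top = Le⇒≤ (x-top (from 𝟙))

  to-atom : ∀ {u} → IsAtom R u → Atom L (to u)
  to-atom {u} (u-not-bottom , below-u) = (minimum (to u) , 𝟘≉u) , nothing-between
    where
    𝟘≉u : ¬ 𝟘 ≈ to u
    𝟘≉u 𝟘≈u = u-not-bottom (λ z → reflect u z (≤-trans (reflexive (Eq.sym 𝟘≈u)) (minimum (to z))))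
    nothing-between : ¬ (∃[ z ] ((𝟘 ≤ z × ¬ 𝟘 ≈ z) × (z ≤ to u × ¬ z ≈ to u)))
    nothing-between (z , (_ , 𝟘≉z) , z≤u , z≉u) with below-u (from z) (≤to⇒Le z≤u)
    ... | inj₁ z-bottom = 𝟘≉z (Eq.sym (from-bottom⇒≈𝟘 z-bottom))
    ... | inj₂ refl     = z≉u (Eq.sym (to∘from z))

  threeAtoms : Valid R → ThreeRepAtoms R → ThreeAtoms
  threeAtoms valid T = record
    { p = to p ; q = to q ; r = to r
    ; p-atom = to-atom p-atom ; q-atom = to-atom q-atom ; r-atom = to-atom r-atom
    ; p≉q = p≢q ∘ to-injective valid ; p≉r = p≢r ∘ to-injective valid ; q≉r = q≢r ∘ to-injective valid
    ; 𝟙≤q∨r = from-top⇒𝟙≤ (join-top _ (to≤⇒Le (x≤x∨y _ _)) (to≤⇒Le (y≤x∨y _ _)))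
    }
    where open ThreeRepAtoms T

  twoBranches : RepTwoBranches R → TwoBranches
  twoBranches B = record
    { c = to c ; d = to d ; t₁ = to t₁ ; t₂ = to t₂
    ; c≰d = c≰d ∘ reflect c d
    ; d≰c = d≰c ∘ reflect d c
    ; neither⇒≈𝟘 = λ c≰x d≰x → from-bottom⇒≈𝟘 (neither⇒bottom _ (c≰x ∘ Le⇒to≤) (d≰x ∘ Le⇒to≤))
    ; both⇒𝟙≤ = λ c≤x d≤x → from-top⇒𝟙≤ (both⇒top _ (to≤⇒Le c≤x) (to≤⇒Le d≤x))
    ; t₁-greatest = record { c≰t = c≰t₁ ∘ reflect c t₁ ; ≤t = λ c≰x → Le⇒≤to (≤t₁ _ (c≰x ∘ Le⇒to≤)) }
    ; t₂-greatest = record { c≰t = d≰t₂ ∘ reflect d t₂ ; ≤t = λ d≰x → Le⇒≤to (≤t₂ _ (d≰x ∘ Le⇒to≤)) }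
    }
    where open RepTwoBranches B

¬adjunctOfTwoChains : ∀ {L} → LatticeFacts.ThreeAtoms L → ¬ AdjunctOfTwoChains L
¬adjunctOfTwoChains _ (chain _ , _ , _ , ())
¬adjunctOfTwoChains {L} T ((chain _ ] _ , _ [ _) , _ , ρ , _) =
  [ incomparable p-atom q-atom p≉q
  , [ incomparable p-atom r-atom p≉r , incomparable q-atom r-atom q≉r ] ]
    (twoChains-comparable-pair (from p) (from q) (from r))
  where
  open BoundedLattice L using (_≈_)
  open LatticeFacts.ThreeAtoms T
  open RepresentedBy ρ
  incomparable : ∀ {x y} → Atom L x → Atom L y → ¬ x ≈ y → ¬ Comparable (Le _) (from x) (from y)
  incomparable x-atom y-atom x≉y =
    LatticeFacts.atoms-incomparable L x-atom y-atom x≉y ∘ Sum.map (Transfer.Le⇒≤ ρ) (Transfer.Le⇒≤ ρ)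
¬adjunctOfTwoChains _ (((_ ] _ , _ [ _) ] _ , _ [ _) , _ , _ , ())

theorem2p16 : (L : BoundedLattice 0ℓ 0ℓ 0ℓ) → LowerDismantlable01 L →
    let open BoundedLattice L renaming (⊥ to 𝟘) in
    (ZDCompleteBipartite L ⇔ AdjunctOfTwoChains L) ×
    (ZDCompleteBipartite L ⇔ (ExactlyTwo L (Atom L) × ExactlyTwo L (DualAtom L))) ×
    (ZDCompleteBipartite L ⇔
      (∃[ P₁ ] ∃[ P₂ ] (IsMinimalPrimeIdeal L P₁ × IsMinimalPrimeIdeal L P₂ ×
        (∀ x → P₁ x → P₂ x → x ≈ 𝟘)))) ×
    (ZDCompleteBipartite L ⇔ ZeroDistributive L)
theorem2p16 L (chain _ , _ , _ , _ , ())
theorem2p16 L (R@(chain k₀ ] a , b [ k₁) , valid , ρ , lower , pair01) =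
  both-hold⇒⇔ bipartite (R , valid , ρ , tt) ,
  both-hold⇒⇔ bipartite (twoBranches-exactlyTwoAtoms ≤-dec B , twoBranches-exactlyTwoDualAtoms ≤-dec B) ,
  both-hold⇒⇔ bipartite (twoBranches-disjointMinimalPrimes ≤-dec B) ,
  both-hold⇒⇔ bipartite (twoBranches-zeroDistributive ≤-dec B)
  where
  open LatticeFacts L
  open Transfer ρ using (≤-dec; twoBranches)
  B : TwoBranches
  B = twoBranches (pair01-twoBranches k₀ a b k₁ valid lower pair01)
  bipartite : ZDCompleteBipartite L
  bipartite = twoBranches-completeBipartite ≤-dec B
theorem2p16 L ((R₂ ] a₂ , b₂ [ k₂) ] a , b [ k , valid , ρ , lower , pair01) =
  both-fail⇒⇔ ¬bipartite (¬adjunctOfTwoChains T) ,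
  both-fail⇒⇔ ¬bipartite (¬exactlyTwoAtoms T ∘ proj₁) ,
  both-fail⇒⇔ ¬bipartite (¬disjointMinimalPrimes ≤-dec T) ,
  both-fail⇒⇔ ¬bipartite (¬zeroDistributive ≤-dec T)
  where
  open LatticeFacts L
  open Transfer ρ using (≤-dec; threeAtoms)
  T : ThreeAtoms
  T = threeAtoms valid (threeRepAtoms R₂ a₂ b₂ k₂ a b k valid lower pair01)
  ¬bipartite : ¬ ZDCompleteBipartite L
  ¬bipartite = ¬completeBipartite ≤-dec T
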